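{- Let $N = q^k n^2$ be an odd perfect number, where $q$ is a prime with $q \equiv k \equiv 1 \pmod 4$ and $\gcd(q,n)=1$. Then $$I(n^2) \leq 2 - \frac{5}{3q}.$$
   Context: For a positive integer $N$, $\sigma(N)$ denotes the sum of the positive divisors of $N$; $N$ is perfect if $\sigma(N)=2N$. The abundancy index of a positive integer $w$ is $I(w)=\sigma(w)/w$. -}

module Defs where

open import Data.Nat using (ℕ; zero; suc; _+_; _*_; _^_; _≤_; _<_)
open import Data.Nat.Divisibility using (_∣_; _∣?_)
open import Data.Nat.ListAction using (sum)
open import Data.List using (List; filter; upTo; map)
open import Data.Integer using (+_)
open import Data.Rational using (ℚ; _/_; 0ℚ)
open import Data.Product using (_×_)

σ : ℕ → ℕ
σ N = sum (filter (λ d → d ∣? N) (map suc (upTo N)))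

Perfect : ℕ → Set
Perfect N = (0 < N) × (σ N ≡ 2 * N)
  where open import Relation.Binary.PropositionalEquality using (_≡_)

-- abundancy index I(w) = σ(w)/w, for positive w (value at 0 is irrelevant junk).
I : ℕ → ℚ
I zero = 0ℚ
I (suc m) = (+ σ (suc m)) / suc m

module Submission where

-- Since q ∤ m, the products q^k·d and q^(k-1)·d for d ∣ m are pairwise distinct
-- divisors of N, so  σ(N) ≥ (q^k + q^(k-1))·σ(m).  When N is perfect this reads
-- 2q^k·m ≥ (q^k + q^(k-1))·σ(m), i.e.  I(m) ≤ 2q/(q+1).  Finally
--   2 − 5/(3q) − 2q/(q+1) = (q − 5)/(3q(q+1)) ≥ 0,
-- and q ≥ 5 because q is a prime with q ≡ 1 (mod 4).

open import Defs
open import Data.Nat using (ℕ; _*_; _^_; _%_)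
open import Data.Nat.Properties using (m*n≢0)
open import Data.Nat.Primality using (Prime; prime⇒nonZero)
open import Data.Nat.Coprimality using (Coprime)
open import Data.Integer using (+_)
open import Data.Rational using (ℚ; _/_; _≤_; _-_)
open import Relation.Binary.PropositionalEquality using (_≡_)

import Data.Nat as ℕ
open import Data.Nat using (zero; suc; _+_; NonZero)
import Data.Nat.Properties as ℕ
import Data.Nat.Tactic.RingSolver as ℕ-Solver
open import Data.Nat.Divisibility using (_∣_; _∣?_; divides; ∣-refl; ∣-trans; ∣⇒≤; 0∣⇒≡0; *-monoʳ-∣; n∣m*n)
open import Data.Nat.Coprimality using (coprime-divisor)
open import Data.Nat.Primality using (¬prime[1])
open import Data.Nat.ListAction using (sum)
open import Data.Nat.ListAction.Properties using (sum-++)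
import Data.Integer as ℤ
import Data.Integer.Properties as ℤ
open import Data.Integer.Tactic.RingSolver using (solve-∀)
import Data.Rational as ℚ
open import Data.Rational using (toℚᵘ)
open import Data.Rational.Properties using (toℚᵘ-cancel-≤; toℚᵘ-fromℚᵘ; toℚᵘ-homo-+; toℚᵘ-homo‿-)
import Data.Rational.Unnormalised as ℚᵘ
import Data.Rational.Unnormalised.Properties as ℚᵘ
open import Data.List using (List; []; _∷_; _++_; filter; map; upTo)
open import Data.List.Membership.Propositional using (_∈_)
open import Data.List.Membership.Propositional.Properties
  using (∈-filter⁺; ∈-filter⁻; ∈-map⁺; ∈-map⁻; ∈-upTo⁺; ∈-++⁻)
open import Data.List.Relation.Unary.Any using (here; there)
open import Data.List.Relation.Unary.All as All using ()
open import Data.List.Relation.Unary.AllPairs using (_∷_)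
open import Data.List.Relation.Unary.Unique.Propositional using (Unique)
import Data.List.Relation.Unary.Unique.Propositional.Properties as Unique
open import Data.List.Relation.Binary.Disjoint.Propositional using (Disjoint)
open import Data.Product using (_,_; proj₁; proj₂)
open import Data.Sum using (inj₁; inj₂)
open import Relation.Nullary using (¬_; contradiction)
open import Relation.Binary.PropositionalEquality using (refl; sym; trans; cong; cong₂; subst; module ≡-Reasoning)

delete : ∀ {x} (ys : List ℕ) → x ∈ ys → List ℕ
delete (y ∷ ys) (here _)  = ys
delete (y ∷ ys) (there p) = y ∷ delete ys p

sum-delete : ∀ {x} (ys : List ℕ) (p : x ∈ ys) → sum ys ≡ x + sum (delete ys p)
sum-delete (y ∷ ys) (here refl) = refl
sum-delete {x} (y ∷ ys) (there p) = begin
  y + sum ys                    ≡⟨ cong (_+_ y) (sum-delete ys p) ⟩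
  y + (x + sum (delete ys p))   ≡⟨ swap y x (sum (delete ys p)) ⟩
  x + (y + sum (delete ys p))   ∎
  where
  open ≡-Reasoning
  swap : ∀ a b c → a + (b + c) ≡ b + (a + c)
  swap = ℕ-Solver.solve-∀

∈-delete : ∀ {x z} (ys : List ℕ) (p : x ∈ ys) → z ∈ ys → ¬ x ≡ z → z ∈ delete ys p
∈-delete (y ∷ ys) (here refl) (here refl) x≢z = contradiction refl x≢z
∈-delete (y ∷ ys) (here _)    (there z∈)  _   = z∈
∈-delete (y ∷ ys) (there p)   (here z≡y)  _   = here z≡y
∈-delete (y ∷ ys) (there p)   (there z∈) x≢z = there (∈-delete ys p z∈ x≢z)

sum-mono-⊆ : ∀ (xs ys : List ℕ) → Unique xs → (∀ {z} → z ∈ xs → z ∈ ys) → sum xs ℕ.≤ sum ys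
sum-mono-⊆ []       ys _             _    = ℕ.z≤n
sum-mono-⊆ (x ∷ xs) ys (x∉xs ∷ uniq) xs⊆ys = begin
  x + sum xs                 ≤⟨ ℕ.+-monoʳ-≤ x (sum-mono-⊆ xs (delete ys x∈ys) uniq rest⊆) ⟩
  x + sum (delete ys x∈ys)   ≡⟨ sum-delete ys x∈ys ⟨
  sum ys                     ∎
  where
  open ℕ.≤-Reasoning
  x∈ys = xs⊆ys (here refl)
  rest⊆ : ∀ {z} → z ∈ xs → z ∈ delete ys x∈ys
  rest⊆ z∈xs = ∈-delete ys x∈ys (xs⊆ys (there z∈xs)) (All.lookup x∉xs z∈xs)

sum-map-* : ∀ c (xs : List ℕ) → sum (map (c *_) xs) ≡ c * sum xs
sum-map-* c []       = sym (ℕ.*-zeroʳ c)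
sum-map-* c (x ∷ xs) = trans (cong (_+_ (c * x)) (sum-map-* c xs)) (sym (ℕ.*-distribˡ-+ c x (sum xs)))

divisors : ℕ → List ℕ
divisors N = filter (_∣? N) (map suc (upTo N))

divisors-unique : ∀ N → Unique (divisors N)
divisors-unique N = Unique.filter⁺ (_∣? N) (Unique.map⁺ ℕ.suc-injective (Unique.upTo⁺ N))

∈-divisors⁺ : ∀ {N x} .{{_ : NonZero N}} → x ∣ N → x ∈ divisors N
∈-divisors⁺ {N} {zero}  0∣N = contradiction (0∣⇒≡0 0∣N) (ℕ.≢-nonZero⁻¹ N)
∈-divisors⁺ {N} {suc y} x∣N = ∈-filter⁺ (_∣? N) (∈-map⁺ suc (∈-upTo⁺ (∣⇒≤ x∣N))) x∣N

∈-divisors⁻ : ∀ {N x} → x ∈ divisors N → x ∣ N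
∈-divisors⁻ {N} x∈ = proj₂ (∈-filter⁻ (_∣? N) {xs = map suc (upTo N)} x∈)

-- If q ∤ m then  σ(q·b·m) ≥ q·b·σ(m) + b·σ(m):  the divisors q·b·d and b·d (d ∣ m)
-- of q·b·m are all distinct, since q·b·d₁ = b·d₂ would force q ∣ d₂ ∣ m.
σ-lower-bound : ∀ q b m .{{_ : NonZero q}} .{{_ : NonZero b}} .{{_ : NonZero m}} → ¬ q ∣ m →
  q * b * σ m + b * σ m ℕ.≤ σ (q * b * m)
σ-lower-bound q b m q∤m = begin
  q * b * σ m + b * σ m   ≡⟨ cong₂ _+_ (sum-map-* (q * b) (divisors m)) (sum-map-* b (divisors m)) ⟨
  sum high + sum low      ≡⟨ sum-++ high low ⟨
  sum (high ++ low)       ≤⟨ sum-mono-⊆ (high ++ low) (divisors (q * b * m)) unique ⊆divisors ⟩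
  σ (q * b * m)           ∎
  where
  open ℕ.≤-Reasoning
  instance
    qb≢0 : NonZero (q * b)
    qb≢0 = m*n≢0 q b
    qbm≢0 : NonZero (q * b * m)
    qbm≢0 = m*n≢0 (q * b) m
  high = map (q * b *_) (divisors m)
  low  = map (b *_) (divisors m)

  disjoint : Disjoint high low
  disjoint (v∈high , v∈low) with ∈-map⁻ (q * b *_) v∈high | ∈-map⁻ (b *_) v∈low
  ... | d₁ , _ , refl | d₂ , d₂∈ , qbd₁≡bd₂ = q∤m (∣-trans q∣d₂ (∈-divisors⁻ d₂∈))
    where
    qd₁≡d₂ : q * d₁ ≡ d₂
    qd₁≡d₂ = ℕ.*-cancelˡ-≡ (q * d₁) d₂ b
      (trans (sym (ℕ.*-assoc b q d₁)) (trans (cong (_* d₁) (ℕ.*-comm b q)) qbd₁≡bd₂))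
    q∣d₂ : q ∣ d₂
    q∣d₂ = divides d₁ (trans (sym qd₁≡d₂) (ℕ.*-comm q d₁))

  unique : Unique (high ++ low)
  unique = Unique.++⁺ (Unique.map⁺ (ℕ.*-cancelˡ-≡ _ _ (q * b)) (divisors-unique m))
                      (Unique.map⁺ (ℕ.*-cancelˡ-≡ _ _ b) (divisors-unique m)) disjoint

  ⊆divisors : ∀ {z} → z ∈ high ++ low → z ∈ divisors (q * b * m)
  ⊆divisors z∈ with ∈-++⁻ high z∈
  ... | inj₁ z∈high with d , d∈ , refl ← ∈-map⁻ (q * b *_) z∈high
      = ∈-divisors⁺ (*-monoʳ-∣ (q * b) (∈-divisors⁻ d∈))
  ... | inj₂ z∈low with d , d∈ , refl ← ∈-map⁻ (b *_) z∈low
      = ∈-divisors⁺ (∣-trans (*-monoʳ-∣ b (∈-divisors⁻ d∈))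
                             (subst (b * m ∣_) (sym (ℕ.*-assoc q b m)) (n∣m*n q)))

perfect⇒abundancy-bound : ∀ q j m .{{_ : NonZero q}} .{{_ : NonZero m}} → ¬ q ∣ m →
  Perfect (q ^ suc j * m) → suc q * σ m ℕ.≤ 2 * q * m
perfect⇒abundancy-bound q j m q∤m (_ , perfect) = ℕ.*-cancelˡ-≤ (q ^ j) (begin
  q ^ j * (suc q * σ m)           ≡⟨ spread q (q ^ j) (σ m) ⟩
  q * q ^ j * σ m + q ^ j * σ m   ≤⟨ σ-lower-bound q (q ^ j) m q∤m ⟩
  σ (q ^ suc j * m)               ≡⟨ perfect ⟩
  2 * (q * q ^ j * m)             ≡⟨ gather q (q ^ j) m ⟩
  q ^ j * (2 * q * m)             ∎)
  where
  open ℕ.≤-Reasoning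
  instance
    q^j≢0 : NonZero (q ^ j)
    q^j≢0 = ℕ.m^n≢0 q j
  spread : ∀ q p s → p * (suc q * s) ≡ q * p * s + p * s
  spread = ℕ-Solver.solve-∀
  gather : ∀ q p m → 2 * (q * p * m) ≡ p * (2 * q * m)
  gather = ℕ-Solver.solve-∀

-- For q ≥ 5,  s/M ≤ 2q/(q+1)  implies  s/M ≤ 2 − 5/(3q),  in cross-multiplied form:
-- the gap  2q/(q+1) − (2 − 5/(3q)) = (5 − q)/(3q(q+1))  is not positive.
weaken-bound : ∀ q s M → 5 ℕ.≤ q → suc q * s ℕ.≤ 2 * q * M →
  s * (3 * q) + 5 * M ℕ.≤ 2 * (3 * q) * M
weaken-bound q s M 5≤q h = ℕ.*-cancelˡ-≤ (suc q) (begin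
  suc q * (s * (3 * q) + 5 * M)          ≡⟨ expand q s M ⟩
  3 * q * (suc q * s) + 5 * suc q * M    ≤⟨ ℕ.+-mono-≤ (ℕ.*-monoʳ-≤ (3 * q) h) (ℕ.*-monoˡ-≤ M 5[q+1]≤6q) ⟩
  3 * q * (2 * q * M) + 6 * q * M        ≡⟨ collect q M ⟩
  suc q * (2 * (3 * q) * M)              ∎)
  where
  open ℕ.≤-Reasoning
  expand : ∀ q s M → suc q * (s * (3 * q) + 5 * M) ≡ 3 * q * (suc q * s) + 5 * suc q * M
  expand = ℕ-Solver.solve-∀
  collect : ∀ q M → 3 * q * (2 * q * M) + 6 * q * M ≡ suc q * (2 * (3 * q) * M)
  collect = ℕ-Solver.solve-∀
  5[q+1]≤6q : 5 * suc q ℕ.≤ 6 * q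
  5[q+1]≤6q = begin
    5 * suc q   ≡⟨ ℕ.*-suc 5 q ⟩
    5 + 5 * q   ≤⟨ ℕ.+-monoˡ-≤ (5 * q) 5≤q ⟩
    q + 5 * q   ∎

cross-multiplied : ∀ s D M → s * D + 5 * M ℕ.≤ 2 * D * M →
  + s ℤ.* + D ℤ.≤ (+ 2 ℤ.* + D ℤ.- + 5) ℤ.* + M
cross-multiplied s D M h = begin
  + s ℤ.* + D                                     ≡⟨ cancel5M (+ s) (+ D) (+ M) ⟩
  + s ℤ.* + D ℤ.+ + 5 ℤ.* + M ℤ.- + 5 ℤ.* + M     ≡⟨ cong (ℤ._- + 5 ℤ.* + M) lhs ⟨
  + (s * D + 5 * M) ℤ.- + 5 ℤ.* + M               ≤⟨ ℤ.+-monoˡ-≤ (ℤ.- (+ 5 ℤ.* + M)) (ℤ.+≤+ h) ⟩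
  + (2 * D * M) ℤ.- + 5 ℤ.* + M                   ≡⟨ cong (ℤ._- + 5 ℤ.* + M) rhs ⟩
  + 2 ℤ.* + D ℤ.* + M ℤ.- + 5 ℤ.* + M             ≡⟨ factorM (+ D) (+ M) ⟩
  (+ 2 ℤ.* + D ℤ.- + 5) ℤ.* + M                   ∎
  where
  open ℤ.≤-Reasoning
  lhs : + (s * D + 5 * M) ≡ + s ℤ.* + D ℤ.+ + 5 ℤ.* + M
  lhs = trans (ℤ.pos-+ (s * D) (5 * M)) (cong₂ ℤ._+_ (ℤ.pos-* s D) (ℤ.pos-* 5 M))
  rhs : + (2 * D * M) ≡ + 2 ℤ.* + D ℤ.* + M
  rhs = trans (ℤ.pos-* (2 * D) M) (cong (ℤ._* + M) (ℤ.pos-* 2 D))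
  cancel5M : ∀ x y z → x ℤ.* y ≡ x ℤ.* y ℤ.+ + 5 ℤ.* z ℤ.- + 5 ℤ.* z
  cancel5M = solve-∀
  factorM : ∀ y z → + 2 ℤ.* y ℤ.* z ℤ.- + 5 ℤ.* z ≡ (+ 2 ℤ.* y ℤ.- + 5) ℤ.* z
  factorM = solve-∀

-- If  σ(M)·D + 5M ≤ 2DM  then  I(M) ≤ 2 − 5/D : the cross-multiplied inequality read
-- back through the unnormalised rationals, where both sides have explicit form.
abundancy≤ : ∀ M D .{{_ : NonZero M}} .{{_ : NonZero D}} →
  σ M * D + 5 * M ℕ.≤ 2 * D * M → I M ≤ + 2 / 1 - + 5 / D
abundancy≤ (suc m) (suc d) h = toℚᵘ-cancel-≤ (begin
  toℚᵘ (I (suc m))                  ≃⟨ toℚᵘ-fromℚᵘ (+ σ (suc m) ℚᵘ./ suc m) ⟩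
  + σ (suc m) ℚᵘ./ suc m            ≤⟨ ℚᵘ.*≤* crossed ⟩
  + 2 ℚᵘ./ 1 ℚᵘ.- + 5 ℚᵘ./ suc d    ≃⟨ difference ⟨
  toℚᵘ (+ 2 / 1 - + 5 / suc d)      ∎)
  where
  open ℚᵘ.≤-Reasoning
  crossed : + σ (suc m) ℤ.* + (1 * suc d) ℤ.≤ (+ 2 ℤ.* + suc d ℤ.- + 5) ℤ.* + suc m
  crossed = subst (λ D → + σ (suc m) ℤ.* + D ℤ.≤ (+ 2 ℤ.* + suc d ℤ.- + 5) ℤ.* + suc m)
                  (sym (ℕ.*-identityˡ (suc d)))
                  (cross-multiplied (σ (suc m)) (suc d) (suc m) h)
  difference : toℚᵘ (+ 2 / 1 - + 5 / suc d) ℚᵘ.≃ + 2 ℚᵘ./ 1 ℚᵘ.- + 5 ℚᵘ./ suc d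
  difference = ℚᵘ.≃-trans (toℚᵘ-homo-+ (+ 2 / 1) (ℚ.- (+ 5 / suc d)))
    (ℚᵘ.+-cong (toℚᵘ-fromℚᵘ (+ 2 ℚᵘ./ 1))
               (ℚᵘ.≃-trans (toℚᵘ-homo‿- (+ 5 / suc d)) (ℚᵘ.-‿cong (toℚᵘ-fromℚᵘ (+ 5 ℚᵘ./ suc d)))))

prime≡1[mod4]⇒5≤ : ∀ q → Prime q → q % 4 ≡ 1 → 5 ℕ.≤ q
prime≡1[mod4]⇒5≤ 1 p _ = contradiction p ¬prime[1]
prime≡1[mod4]⇒5≤ (suc (suc (suc (suc (suc t))))) _ _ = ℕ.m≤m+n 5 t

coprime⇒∤square : ∀ {q n} → Prime q → Coprime q n → ¬ q ∣ n ^ 2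
coprime⇒∤square {q} {n} qp cop q∣n² = ¬prime[1] (subst Prime (cop (∣-refl , q∣n)) qp)
  where
  q∣n : q ∣ n
  q∣n = subst (q ∣_) (ℕ.*-identityʳ n) (coprime-divisor cop q∣n²)

-- The theorem: with m = n², combine the abundancy bound I(m) ≤ 2q/(q+1) for the
-- perfect number q^k·m (k ≥ 1 since k ≡ 1 mod 4) with q ≥ 5.
lemma2 : (q k n : ℕ) → (qp : Prime q) →
    Perfect (q ^ k * n ^ 2) → (q ^ k * n ^ 2) % 2 ≡ 1 →
    q % 4 ≡ 1 → k % 4 ≡ 1 → Coprime q n →
    I (n ^ 2) ≤ (+ 2 / 1) - ((+ 5 / (3 * q)) {{m*n≢0 3 q {{_}} {{prime⇒nonZero qp}}}})
lemma2 q zero    n qp _       _ _     ()  _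
lemma2 q (suc j) n qp perfect _ q≡1 _ cop =
  abundancy≤ (n ^ 2) (3 * q) (weaken-bound q (σ (n ^ 2)) (n ^ 2) 5≤q I[n²]≤2q/[q+1])
  where
  instance
    q≢0 : NonZero q
    q≢0 = prime⇒nonZero qp
    n²≢0 : NonZero (n ^ 2)
    n²≢0 = ℕ.m*n≢0⇒n≢0 (q ^ suc j) {{ℕ.>-nonZero (proj₁ perfect)}}
    3q≢0 : NonZero (3 * q)
    3q≢0 = m*n≢0 3 q
  5≤q : 5 ℕ.≤ q
  5≤q = prime≡1[mod4]⇒5≤ q qp q≡1
  I[n²]≤2q/[q+1] : suc q * σ (n ^ 2) ℕ.≤ 2 * q * n ^ 2
  I[n²]≤2q/[q+1] = perfect⇒abundancy-bound q j (n ^ 2) (coprime⇒∤square qp cop) perfect
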